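{- Let $\mathcal{A}=\langle Q,q_0,\Sigma,\delta,F\rangle$ be a deterministic Muller automaton and $\mathfrak{M}$ its associated monoid. Let $\bar{x}_1,\dots,\bar{x}_k\in\mathfrak{M}$ be such that the product $\bar{x}_1\bar{x}_2\cdots\bar{x}_k$ is increasing. Then there exists $i\in\{1,\dots,k-1\}$ such that $\bar{x}_i\bar{x}_{i+1}$ is increasing; moreover, for all $1\le r\le i$ and $i<r'\le k$, the product $\bar{x}_r\bar{x}_{r+1}\cdots\bar{x}_{r'}$ is increasing.
   Context: Elements of $\mathfrak{M}$ are directed graphs on vertex set $Q$ with edges labeled by subsets of $Q$. The product $\bar{x}\cdot\bar{y}$ has an edge $q_1\xrightarrow{S_1\cup S_2}q_2$ iff there is $q'$ with an edge $q_1\xrightarrow{S_1}q'$ in $\bar{x}$ and $q'\xrightarrow{S_2}q_2$ in $\bar{y}$. For a letter $a\in\Sigma$, $h(a)$ has an edge $q_1\xrightarrow{\{q_1,q_2\}}q_2$ iff $\delta(q_1,a)=q_2$; $\mathfrak{M}$ is the monoid generated by $\{h(a):a\in\Sigma\}$ together with the neutral element $h(\epsilon)$ (edges $q\xrightarrow{\{q\}}q$). Since $\mathcal{A}$ is deterministic, in each $\bar{x}\in\mathfrak{M}$ every $q\in Q$ has exactly one outgoing edge; its label is called the set of states seen from $q$ in $\bar{x}$. A product $\bar{x}_1\cdots\bar{x}_k$ (with value $\bar{x}$) is increasing if there exists $q\in Q$ such that the states seen from $q$ in $\bar{x}_1$ form a strict subset of the states seen from $q$ in $\bar{x}$. -}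

module Defs where

open import Data.Nat using (ℕ; zero; suc; _∸_)
open import Data.Fin using (Fin)
open import Data.Fin.Subset using (Subset; _∪_; ⁅_⁆; _⊂_)
open import Data.List using (List)
open import Data.Product using (_×_; _,_; proj₁; proj₂; ∃)

record Muller (n m : ℕ) : Set where
  field
    q₀ : Fin n
    δ  : Fin n → Fin m → Fin n
    F  : List (Subset n)

-- A graph on vertex set Q in which every vertex has exactly one outgoing edge,
-- labelled by a subset of Q: vertex q has the edge  q --(proj₂ (g q))--> proj₁ (g q).
Graph : ℕ → Set
Graph n = Fin n → Fin n × Subset n

_·_ : ∀ {n} → Graph n → Graph n → Graph n
(x · y) q = let (q' , S₁) = x q ; (q₂ , S₂) = y q' in (q₂ , S₁ ∪ S₂)

infixl 7 _·_

hε : ∀ {n} → Graph n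
hε q = (q , ⁅ q ⁆)

h : ∀ {n m} → Muller n m → Fin m → Graph n
h A a q = (Muller.δ A q a , ⁅ q ⁆ ∪ ⁅ Muller.δ A q a ⁆)

data InM {n m} (A : Muller n m) : Graph n → Set where
  unit : InM A hε
  gen  : ∀ a → InM A (h A a)
  mul  : ∀ {x y} → InM A x → InM A y → InM A (x · y)

seen : ∀ {n} → Graph n → Fin n → Subset n
seen x q = proj₂ (x q)

-- A product whose first factor is x₁ and whose value is x is increasing.
IncreasingWith : ∀ {n} → (x₁ x : Graph n) → Set
IncreasingWith x₁ x = ∃ λ q → seen x₁ q ⊂ seen x q

seg : ∀ {n} → (ℕ → Graph n) → ℕ → ℕ → Graph n
seg x r zero    = x r
seg x r (suc l) = x r · seg x (suc r) l

IncreasingProd : ∀ {n} → (ℕ → Graph n) → ℕ → ℕ → Set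
IncreasingProd x r r' = IncreasingWith (x r) (seg x r (r' ∸ r))

-- Follow the run of a state q through the factors: the states seen from q in
-- x₁⋯x_k are the union of the states seen in each factor x_j from the state
-- reached there. If the product is increasing at q, some factor sees a state
-- outside T = seen (x₁) q; let x_{i+1} be the first such factor. Every product
-- x_r⋯x_{r'} with r ≤ i < r' contains x_{i+1}, while x_r, from the same run,
-- only sees states of T; so all these products are increasing at the run.
module Submission where

open import Defs
open import Data.Nat using (ℕ; zero; suc; _≤_; _<_; _+_; _∸_; z≤n; s≤s)
open import Data.Nat.Properties
  using ( +-suc; +-identityʳ; m+[n∸m]≡n; ≤-refl; ≤-trans; m≤n⇒m≤1+n; m≤m+n
        ; <⇒≤; <⇒≱; m≤n⇒m<n∨m≡n)
open import Data.Product using (_×_; ∃; _,_; proj₁)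
open import Data.Sum using (inj₁; inj₂)
open import Data.Empty using (⊥-elim)
open import Data.Fin using (Fin)
open import Data.Fin.Subset using (Subset; _∈_; _∉_; _⊆_)
open import Data.Fin.Subset.Properties
  using (p⊆p∪q; q⊆p∪q; x∈p∪q⁻; ⊆-trans; _∈?_; ⊂-irref)
open import Data.Fin.Properties using (any?)
open import Relation.Nullary using (¬_; yes; no)
open import Relation.Nullary.Decidable using (_×-dec_; ¬?)
open import Relation.Unary using (Decidable)
open import Relation.Binary.PropositionalEquality using (refl; subst; sym; cong)

least-witness : ∀ {P : ℕ → Set} → Decidable P → ∀ {m} → P m →
                ∃ λ i → P i × i ≤ m × (∀ j → j < i → ¬ P j)
least-witness P? {zero} p = 0 , p , z≤n , λ _ ()
least-witness P? {suc m} p with P? 0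
... | yes p₀ = 0 , p₀ , z≤n , λ _ ()
... | no ¬p₀ with least-witness (λ j → P? (suc j)) {m} p
...   | i , pᵢ , i≤m , below = suc i , pᵢ , s≤s i≤m , λ where
        zero    _         → ¬p₀
        (suc j) (s≤s j<i) → below j j<i

module _ {n : ℕ} (x : ℕ → Graph n) (q : Fin n) where

  -- The state reached from q after the factors x 1, …, x (j ∸ 1). Position 0
  -- carries no factor; its value q there is junk and never used.
  run : ℕ → Fin n
  run zero          = q
  run (suc zero)    = q
  run (suc (suc j)) = proj₁ (x (suc j) (run (suc j)))

  seen-head⊆seen-seg : ∀ r l s → seen (x r) s ⊆ seen (seg x r l) s
  seen-head⊆seen-seg r zero    s e∈ = e∈
  seen-head⊆seen-seg r (suc l) s e∈ = p⊆p∪q _ e∈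

  seen-factor⊆seen-seg : ∀ {r j} l → 1 ≤ r → r ≤ j → j ≤ r + l →
                         seen (x j) (run j) ⊆ seen (seg x r l) (run r)
  seen-factor⊆seen-seg {r} {j} l 1≤r r≤j j≤r+l with m≤n⇒m<n∨m≡n r≤j
  ... | inj₂ refl = seen-head⊆seen-seg r l (run r)
  ... | inj₁ r<j with l | 1≤r
  ...   | zero  | _ = ⊥-elim (<⇒≱ r<j (subst (j ≤_) (+-identityʳ r) j≤r+l))
  ...   | suc l | s≤s z≤n =
          ⊆-trans (seen-factor⊆seen-seg l (s≤s z≤n) r<j (subst (j ≤_) (+-suc r l) j≤r+l))
                  (q⊆p∪q (seen (x r) (run r)) _)

  ∈-seen-seg⇒∈-seen-factor : ∀ {r} l {e} → 1 ≤ r → e ∈ seen (seg x r l) (run r) →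
                             ∃ λ j → r ≤ j × j ≤ r + l × e ∈ seen (x j) (run j)
  ∈-seen-seg⇒∈-seen-factor {r} zero _ e∈ =
    r , ≤-refl , subst (r ≤_) (sym (+-identityʳ r)) ≤-refl , e∈
  ∈-seen-seg⇒∈-seen-factor {suc r} (suc l) _ e∈
    with x∈p∪q⁻ (seen (x (suc r)) (run (suc r))) _ e∈
  ... | inj₁ e∈head = suc r , ≤-refl , m≤m+n (suc r) (suc l) , e∈head
  ... | inj₂ e∈tail with ∈-seen-seg⇒∈-seen-factor l (s≤s z≤n) e∈tail
  ...   | j , r<j , j≤bound , e∈xj =
        j , <⇒≤ r<j , subst (j ≤_) (sym (cong suc (+-suc r l))) j≤bound , e∈xj

  increasing-if-factor-escapes : ∀ {r j r' e} → 1 ≤ r → r ≤ j → j ≤ r' →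
                                 e ∈ seen (x j) (run j) → e ∉ seen (x r) (run r) →
                                 IncreasingProd x r r'
  increasing-if-factor-escapes {r} {j} {r'} 1≤r r≤j j≤r' e∈xj e∉xr =
    run r , seen-head⊆seen-seg r (r' ∸ r) (run r) ,
    _ , seen-factor⊆seen-seg (r' ∸ r) 1≤r r≤j j≤r+[r'∸r] e∈xj , e∉xr
    where
    j≤r+[r'∸r] : j ≤ r + (r' ∸ r)
    j≤r+[r'∸r] = subst (j ≤_) (sym (m+[n∸m]≡n (≤-trans r≤j j≤r'))) j≤r'

  Escapes : Subset n → ℕ → Set
  Escapes T j = ∃ λ e → e ∈ seen (x j) (run j) × e ∉ T

  escapes? : ∀ T → Decidable (Escapes T)
  escapes? T j = any? λ e → (e ∈? seen (x j) (run j)) ×-dec ¬? (e ∈? T)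

  first-escape : ∀ {T j} → Escapes T (suc j) → ¬ Escapes T 1 →
                 ∃ λ i → 1 ≤ i × i ≤ j × Escapes T (suc i)
                   × (∀ r → 1 ≤ r → r ≤ i → ¬ Escapes T r)
  first-escape {T} escapes-at-1+j x₁-stays
    with least-witness (λ i → escapes? T (suc i)) escapes-at-1+j
  ... | zero  , x₁-escapes , _ = ⊥-elim (x₁-stays x₁-escapes)
  ... | suc i , escapes , i≤j , earlier-stay =
        suc i , s≤s z≤n , i≤j , escapes , λ where (suc r) _ (s≤s r≤i) → earlier-stay r (s≤s r≤i)

lemma19 : ∀ {n m} (A : Muller n m) (k : ℕ) (x : ℕ → Graph n)
          → (∀ i → 1 ≤ i → i ≤ k → InM A (x i))
          → IncreasingProd x 1 k
          → ∃ λ i → 1 ≤ i × i < k × IncreasingProd x i (suc i)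
              × (∀ r r' → 1 ≤ r → r ≤ i → i < r' → r' ≤ k → IncreasingProd x r r')
lemma19 A zero    x _ (_ , x₁⊂x₁) = ⊥-elim (⊂-irref refl x₁⊂x₁)
lemma19 A (suc k) x _ (q , _ , e , e∈seg , e∉T)
  with ∈-seen-seg⇒∈-seen-factor x q k (s≤s z≤n) e∈seg
... | suc j , _ , j≤k , e∈xj
  with first-escape x q (e , e∈xj , e∉T) (λ (e , e∈ , e∉) → e∉ e∈)
... | i , 1≤i , i≤j , (e' , e'∈ , e'∉T) , earlier-stay =
      i , 1≤i , i<k , increasing i (suc i) 1≤i ≤-refl ≤-refl i<k , increasing
  where
  i<k : i < suc k
  i<k = ≤-trans (s≤s i≤j) j≤k
  increasing : ∀ r r' → 1 ≤ r → r ≤ i → i < r' → r' ≤ suc k → IncreasingProd x r r'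
  increasing r r' 1≤r r≤i i<r' _ =
    increasing-if-factor-escapes x q 1≤r (m≤n⇒m≤1+n r≤i) i<r' e'∈
      λ e'∈xr → earlier-stay r 1≤r r≤i (e' , e'∈xr , e'∉T)
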